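{- For every type $\sigma$, let $Y_\sigma=\lambda y^{\sigma\to\sigma}.(\lambda x^{\mu t.(t\to\sigma)}.y(xx))(\lambda x^{\mu t.(t\to\sigma)}.y(xx)):(\sigma\to\sigma)\to\sigma$. Then for every environment $\varepsilon$, $[\![Y_\sigma]\!]\varepsilon=\mathrm{Pr}\big(f\in D_{\sigma\to\sigma}\mapsto\bigcup_{n\ge 0}f^n(\bot)\big)$; in particular $([\![Y_\sigma]\!]\varepsilon)\,f$ is the least fixed point of the function $d\mapsto f\,d$ on $D_\sigma$.
   Context: Types: type expressions $\sigma ::= t \mid \sigma+\sigma \mid \sigma\times\sigma\mid \sigma\to\sigma\mid \mu t.\sigma\mid \mathrm{void}$; types are closed type expressions; $\sigma\approx\tau$ iff $\sigma,\tau$ have the same type tree (the set of finite simple-type prefixes, built from $\mathrm{void},+,\times,\to$ with $\mathrm{void}$ below everything, of the repeated unfoldings $\mu t.\tau\rhd\tau[\mu t.\tau/t]$). Typing rules for the $\lambda$-calculus with typed variables $x^\sigma$ ($x^\sigma:\sigma$; $M:\tau\Rightarrow\lambda x^\sigma.M:\sigma\to\tau$; $M:\sigma\to\tau,N:\sigma\Rightarrow MN:\tau$) plus $M:\sigma,\sigma\approx\tau\Rightarrow M:\tau$; thus $x^{\mu t.(t\to\sigma)}x^{\mu t.(t\to\sigma)}:\sigma$. Semantics: a prime system $(A,\asymp,\le)$ has primes $A$, reflexive symmetric consistency $\asymp$, partial order $\le$, with $a\asymp b, c\le b\Rightarrow a\asymp c$; its elements are downward closed pairwise consistent subsets, ordered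 by $\subseteq$, $\bot=\emptyset$, $\downarrow X=\{a\mid\exists b\in X,a\le b\}$. Sum: primes $\{i\}\cup(\{i\}\times A_i)$ ($i=0,1$), consistent iff same side and components consistent, $i\le$ everything on side $i$, $(i,a)\le(i,b)$ iff $a\le_ib$. Product: primes $(\{0\}\times A_0)\cup(\{1\}\times A_1)$, different sides always consistent, same side componentwise. Function space $\mathbf A\to\mathbf B$: primes $(X,b)$, $X$ a finite pairwise consistent, pairwise incomparable subset of $A$, $b\in B$; $(X,a)\asymp(Y,b)$ iff ($X$ elementwise consistent with $Y$ implies $a\asymp b$); $(X,a)\le(Y,b)$ iff $Y\subseteq\downarrow X$, $a\le b$; element $r$ acts as the continuous function $r\,d=\{a\mid\exists X\subseteq d,(X,a)\in r\}$, an order isomorphism onto continuous functions with inverse $\mathrm{Pr}(f)=\{(X,a)\mid a\in f(\downarrow X)\}$. For a type tree, $\mathbf P_0$ is the empty system, $\mathbf P_{n+1}(\mathrm{void})$ empty, $\mathbf P_{n+1}(\sigma\star\tau)=\mathbf P_n(\sigma)\star\mathbf P_n(\tau)$, $\mathbf P=\bigcup_n\mathbf P_n$ (increasing chain of subsystems); $D_\sigma$ is the set of elements of $\mathbf P$ of the type tree of $\sigma$. In $f^n(\bot)$, $f\in D_{\sigma\to\sigma}$ acts as a function. Environments $\varepsilon$ map $x^\sigma$ into $D_\sigma$; $[\![x]\!]\varepsilon=\varepsilon(x)$, $[\![\lambda x^\sigma.M]\!]\varepsilon=\mathrm{Pr}(d\mapsto[\![M]\!](\varepsilon[x\mapsto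 d]))$, $[\![MN]\!]\varepsilon=([\![M]\!]\varepsilon)([\![N]\!]\varepsilon)$. -}

module Defs where

open import Data.Nat using (ℕ; zero; suc)
open import Data.Fin using (Fin; zero; suc)
open import Data.Bool using (Bool; true; false)
open import Data.List using (List; []; _∷_)
open import Data.List.Relation.Unary.All using (All)
open import Data.List.Relation.Unary.Any using (Any)
open import Data.List.Relation.Unary.AllPairs using (AllPairs)
open import Data.Product using (Σ; _×_; _,_)
open import Data.Sum using (_⊎_)
open import Data.Empty using (⊥)
open import Data.Unit using (⊤)
open import Relation.Nullary using (¬_)
open import Relation.Binary.PropositionalEquality using (_≡_)
open import Function.Bundles using (_⇔_)

-- Type expressions (de Bruijn; Ty 0 = closed type expressions = types)

data Ty (n : ℕ) : Set where
  tvar : Fin n → Ty n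
  void : Ty n
  _⊕_  : Ty n → Ty n → Ty n
  _⊗_  : Ty n → Ty n → Ty n
  _⇒_  : Ty n → Ty n → Ty n
  μ    : Ty (suc n) → Ty n      -- μ t. σ  (t = tvar zero)

ext : ∀ {n m} → (Fin n → Fin m) → Fin (suc n) → Fin (suc m)
ext ρ zero    = zero
ext ρ (suc i) = suc (ρ i)

ren : ∀ {n m} → (Fin n → Fin m) → Ty n → Ty m
ren ρ (tvar i) = tvar (ρ i)
ren ρ void     = void
ren ρ (σ ⊕ τ)  = ren ρ σ ⊕ ren ρ τ
ren ρ (σ ⊗ τ)  = ren ρ σ ⊗ ren ρ τ
ren ρ (σ ⇒ τ)  = ren ρ σ ⇒ ren ρ τ
ren ρ (μ σ)    = μ (ren (ext ρ) σ)

exts : ∀ {n m} → (Fin n → Ty m) → Fin (suc n) → Ty (suc m)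
exts s zero    = tvar zero
exts s (suc i) = ren suc (s i)

sub : ∀ {n m} → (Fin n → Ty m) → Ty n → Ty m
sub s (tvar i) = s i
sub s void     = void
sub s (σ ⊕ τ)  = sub s σ ⊕ sub s τ
sub s (σ ⊗ τ)  = sub s σ ⊗ sub s τ
sub s (σ ⇒ τ)  = sub s σ ⇒ sub s τ
sub s (μ σ)    = μ (sub (exts s) σ)

unfold : Ty 1 → Ty 0
unfold τ = sub (λ _ → μ τ) τ

-- The primes of P (all type trees at once).  Side false = 0, true = 1.
--   tag i     : the sum prime i
--   inc i a   : the sum prime (i , a)
--   prj i a   : the product prime (i , a)
--   fun X b   : the function prime (X , b)   (X a finite set, given as a list)

data Prime : Set where
  tag : Bool → Prime
  inc : Bool → Prime → Prime
  prj : Bool → Prime → Prime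
  fun : List Prime → Prime → Prime

data _≤P_ : Prime → Prime → Set where
  tag≤tag : ∀ {i} → tag i ≤P tag i
  tag≤inc : ∀ {i a} → tag i ≤P inc i a
  inc≤inc : ∀ {i a b} → a ≤P b → inc i a ≤P inc i b
  prj≤prj : ∀ {i a b} → a ≤P b → prj i a ≤P prj i b
  fun≤fun : ∀ {X Y a b} → All (λ y → Any (λ x → y ≤P x) X) Y → a ≤P b →
            fun X a ≤P fun Y b

mutual
  _≍_ : Prime → Prime → Set
  tag i   ≍ tag j   = i ≡ j
  tag i   ≍ inc j _ = i ≡ j
  inc i _ ≍ tag j   = i ≡ j
  inc i a ≍ inc j b = i ≡ j × a ≍ b
  prj i a ≍ prj j b = i ≡ j → a ≍ b
  fun X a ≍ fun Y b = Elementwise≍ X Y → a ≍ b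
  _       ≍ _       = ⊥

  Elementwise≍ : List Prime → List Prime → Set
  Elementwise≍ []      Y = ⊤
  Elementwise≍ (x ∷ X) Y = One≍ x Y × Elementwise≍ X Y

  One≍ : Prime → List Prime → Set
  One≍ x []      = ⊤
  One≍ x (y ∷ Y) = (x ≍ y) × One≍ x Y

Incomparable : Prime → Prime → Set
Incomparable a b = ¬ (a ≤P b) × ¬ (b ≤P a)

data HasTy : Prime → Ty 0 → Set where
  tagL : ∀ {σ τ} → HasTy (tag false) (σ ⊕ τ)
  tagR : ∀ {σ τ} → HasTy (tag true) (σ ⊕ τ)
  incL : ∀ {a σ τ} → HasTy a σ → HasTy (inc false a) (σ ⊕ τ)
  incR : ∀ {a σ τ} → HasTy a τ → HasTy (inc true a) (σ ⊕ τ)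
  prjL : ∀ {a σ τ} → HasTy a σ → HasTy (prj false a) (σ ⊗ τ)
  prjR : ∀ {a σ τ} → HasTy a τ → HasTy (prj true a) (σ ⊗ τ)
  funT : ∀ {X b σ τ} → All (λ x → HasTy x σ) X → AllPairs _≍_ X →
         AllPairs Incomparable X → HasTy b τ → HasTy (fun X b) (σ ⇒ τ)
  fold : ∀ {a τ} → HasTy a (unfold τ) → HasTy a (μ τ)

ValidArg : Ty 0 → List Prime → Set
ValidArg σ X = All (λ x → HasTy x σ) X × AllPairs _≍_ X × AllPairs Incomparable X

Elem : Set₁
Elem = Prime → Set

_∈D_ : Elem → Ty 0 → Set
d ∈D σ = (∀ {a} → d a → HasTy a σ)
       × (∀ {a b} → HasTy a σ → a ≤P b → d b → d a)
       × (∀ {a b} → d a → d b → a ≍ b)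

_⊆E_ : Elem → Elem → Set
d ⊆E e = ∀ a → d a → e a

_≐_ : Elem → Elem → Set
d ≐ e = ∀ a → d a ⇔ e a

⊥E : Elem
⊥E _ = ⊥

↓ : Ty 0 → List Prime → Elem
↓ σ X a = HasTy a σ × Any (λ b → a ≤P b) X

appE : Elem → Elem → Elem
appE r d a = Σ (List Prime) (λ X → All d X × r (fun X a))

PrE : Ty 0 → (Elem → Elem) → Elem
PrE σ F (fun X a) = ValidArg σ X × F (↓ σ X) a
PrE σ F _         = ⊥

iter : Elem → ℕ → Elem
iter f zero    = ⊥E
iter f (suc n) = appE f (iter f n)

⋃iter : Elem → Elem
⋃iter f a = Σ ℕ (λ n → iter f n a)

-- Terms with typed variables x^σ (variable = name : ℕ together with type)

data Tm : Set where
  var : ℕ → Ty 0 → Tm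
  lam : ℕ → Ty 0 → Tm → Tm
  app : Tm → Tm → Tm

Env : Set₁
Env = ℕ → Ty 0 → Elem

WellTypedEnv : Env → Set
WellTypedEnv ε = ∀ x σ → ε x σ ∈D σ

_[_,_↦_] : Env → ℕ → Ty 0 → Elem → Env
(ε [ x , σ ↦ d ]) y τ a =
  ((x ≡ y × σ ≡ τ) × d a) ⊎ (¬ (x ≡ y × σ ≡ τ) × ε y τ a)

⟦_⟧ : Tm → Env → Elem
⟦ var x σ ⟧   ε = ε x σ
⟦ lam x σ M ⟧ ε = PrE σ (λ d → ⟦ M ⟧ (ε [ x , σ ↦ d ]))
⟦ app M N ⟧   ε = appE (⟦ M ⟧ ε) (⟦ N ⟧ ε)

-- Y_σ = λy^{σ→σ}.(λx^T.y(xx))(λx^T.y(xx)),  T = μ t.(t → σ);  y = 0, x = 1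

Tself : Ty 0 → Ty 0
Tself σ = μ (tvar zero ⇒ ren suc σ)

Yhalf : Ty 0 → Tm
Yhalf σ = lam 1 (Tself σ)
  (app (var 0 (σ ⇒ σ)) (app (var 1 (Tself σ)) (var 1 (Tself σ))))

Ycomb : Ty 0 → Tm
Ycomb σ = lam 0 (σ ⇒ σ) (app (Yhalf σ) (Yhalf σ))

IsLeastFixedPoint : Ty 0 → (Elem → Elem) → Elem → Set₁
IsLeastFixedPoint σ g d =
  d ∈D σ × (g d ≐ d) × (∀ e → e ∈D σ → g e ≐ e → d ⊆E e)

-- Write T = μt.(t → σ) and, for d ∈ D_{σ→σ}, let H_d = Pr(e ↦ d(e e)) be the meaning of
-- λx^T.y(xx) when y denotes d.  The iterates f^n(⊥) form an element ⋃ f^n(⊥) which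
--     is the least fixed point of f; ⋃ f^n(⊥) is monotone and continuous in f.
--   * Self-application: H_d H_d = ⋃ d^n(⊥).  "⊇" holds because by the β-law H_d H_d is a
--     fixed point of d; "⊆" is an induction on the structure of the primes of H_d.
-- Then [[Y_σ]]ε = Pr(⋃ f^n(⊥)) pointwise, and by the β-law [[Y_σ]]ε f = ⋃ f^n(⊥), the least
-- fixed point of f.

module Submission where

open import Defs
open import Data.Product using (_×_)
open import Function.Bundles using (_⇔_)

open import Data.Bool using (_≟_)
open import Data.Nat using (ℕ; zero; suc; _≤_; z≤n; s≤s; _⊔_)
open import Data.Nat.Properties using (m≤m⊔n; m≤n⊔m)
open import Data.Fin using (Fin; zero; suc)
open import Data.List using (List; []; _∷_; _++_; filter; foldr)
open import Data.List.Relation.Unary.All as All using (All; []; _∷_)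
import Data.List.Relation.Unary.All.Properties as AllP
open import Data.List.Relation.Unary.Any as Any using (Any; here; there)
import Data.List.Relation.Unary.Any.Properties as AnyP
open import Data.List.Relation.Unary.AllPairs using (AllPairs; []; _∷_)
import Data.List.Relation.Unary.AllPairs.Properties as AllPairsP
open import Data.Product using (Σ; ∃; -,_; _,_; proj₁; proj₂; uncurry; swap)
open import Data.Sum using (inj₁; inj₂; [_,_]′)
open import Data.Empty using (⊥-elim)
open import Data.Unit using (⊤; tt)
open import Function using (id)
open import Function.Bundles using (mk⇔; Equivalence)
import Function.Properties.Equivalence as ⇔
open import Relation.Nullary using (¬_; Dec; yes; no; ¬?)
open import Relation.Nullary.Decidable using (map′; _×-dec_; _⊎-dec_; decidable-stable)
open import Relation.Binary.PropositionalEquality using (_≡_; refl; sym; cong; cong₂; subst)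

open Equivalence using (to; from)

-- Below X a : a ∈ ↓X (ignoring types);  Y ⊑ X : Y ⊆ ↓X, the order between function arguments
Below : List Prime → Prime → Set
Below X a = Any (a ≤P_) X

_⊑_ : List Prime → List Prime → Set
Y ⊑ X = All (Below X) Y

mutual
  ≤P-refl : ∀ {a} → a ≤P a
  ≤P-refl {tag _}   = tag≤tag
  ≤P-refl {inc _ _} = inc≤inc ≤P-refl
  ≤P-refl {prj _ _} = prj≤prj ≤P-refl
  ≤P-refl {fun _ _} = fun≤fun ⊑-refl ≤P-refl

  ⊑-refl : ∀ {X} → X ⊑ X
  ⊑-refl {[]}    = []
  ⊑-refl {_ ∷ X} = here ≤P-refl ∷ All.map there (⊑-refl {X})

mutual
  ≤P-trans : ∀ {a b c} → a ≤P b → b ≤P c → a ≤P c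
  ≤P-trans tag≤tag       q                = q
  ≤P-trans tag≤inc       (inc≤inc _)      = tag≤inc
  ≤P-trans (inc≤inc p)   (inc≤inc q)      = inc≤inc (≤P-trans p q)
  ≤P-trans (prj≤prj p)   (prj≤prj q)      = prj≤prj (≤P-trans p q)
  ≤P-trans (fun≤fun c p) (fun≤fun c′ q)   = fun≤fun (⊑-trans c′ c) (≤P-trans p q)

  ⊑-trans : ∀ {X Y Z} → Z ⊑ Y → Y ⊑ X → Z ⊑ X
  ⊑-trans []       _ = []
  ⊑-trans (p ∷ ps) c = Below-trans p c ∷ ⊑-trans ps c

  Below-trans : ∀ {X Y z} → Below Y z → Y ⊑ X → Below X z
  Below-trans (here p)  (q ∷ _)  = ≤-Below p q
  Below-trans (there p) (_ ∷ qs) = Below-trans p qs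

  ≤-Below : ∀ {X y z} → z ≤P y → Below X y → Below X z
  ≤-Below p (here q)  = here (≤P-trans p q)
  ≤-Below p (there q) = there (≤-Below p q)

-- the order is decidable (needed to compute antichains)
mutual
  _≤?_ : ∀ a b → Dec (a ≤P b)
  tag i   ≤? tag j   = map′ (λ { refl → tag≤tag }) (λ { tag≤tag → refl }) (i ≟ j)
  tag i   ≤? inc j _ = map′ (λ { refl → tag≤inc }) (λ { tag≤inc → refl }) (i ≟ j)
  inc i a ≤? inc j b = map′ (λ { (refl , p) → inc≤inc p }) (λ { (inc≤inc p) → refl , p })
                            ((i ≟ j) ×-dec (a ≤? b))
  prj i a ≤? prj j b = map′ (λ { (refl , p) → prj≤prj p }) (λ { (prj≤prj p) → refl , p })
                            ((i ≟ j) ×-dec (a ≤? b))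
  fun X a ≤? fun Y b = map′ (uncurry fun≤fun) (λ { (fun≤fun c p) → c , p })
                            ((Y ⊑? X) ×-dec (a ≤? b))
  tag _   ≤? prj _ _ = no λ ()
  tag _   ≤? fun _ _ = no λ ()
  inc _ _ ≤? tag _   = no λ ()
  inc _ _ ≤? prj _ _ = no λ ()
  inc _ _ ≤? fun _ _ = no λ ()
  prj _ _ ≤? tag _   = no λ ()
  prj _ _ ≤? inc _ _ = no λ ()
  prj _ _ ≤? fun _ _ = no λ ()
  fun _ _ ≤? tag _   = no λ ()
  fun _ _ ≤? inc _ _ = no λ ()
  fun _ _ ≤? prj _ _ = no λ ()

  _⊑?_ : ∀ Y X → Dec (Y ⊑ X)
  []      ⊑? X = yes []
  (y ∷ Y) ⊑? X = map′ (uncurry _∷_) (λ { (p ∷ ps) → p , ps }) (Below? X y ×-dec (Y ⊑? X))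

  Below? : ∀ X y → Dec (Below X y)
  Below? []      y = no λ ()
  Below? (x ∷ X) y = map′ [ here , there ]′ (λ { (here p) → inj₁ p ; (there p) → inj₂ p })
                          ((y ≤? x) ⊎-dec Below? X y)

≍-refl : ∀ {a} → a ≍ a
≍-refl {tag _}   = refl
≍-refl {inc _ _} = refl , ≍-refl
≍-refl {prj _ _} = λ _ → ≍-refl
≍-refl {fun _ _} = λ _ → ≍-refl

Cross : List Prime → List Prime → Set
Cross X Y = All (λ x → All (x ≍_) Y) X

ew⇒cross : ∀ {X Y} → Elementwise≍ X Y → Cross X Y
ew⇒cross {[]}    _        = []
ew⇒cross {_ ∷ _} (p , ps) = one⇒all p ∷ ew⇒cross ps
  where
  one⇒all : ∀ {x Y} → One≍ x Y → All (x ≍_) Y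
  one⇒all {Y = []}    _        = []
  one⇒all {Y = _ ∷ _} (q , qs) = q ∷ one⇒all qs

cross⇒ew : ∀ {X Y} → Cross X Y → Elementwise≍ X Y
cross⇒ew []       = tt
cross⇒ew (p ∷ ps) = all⇒one p , cross⇒ew ps
  where
  all⇒one : ∀ {x Y} → All (x ≍_) Y → One≍ x Y
  all⇒one []       = tt
  all⇒one (q ∷ qs) = q , all⇒one qs

mutual
  ≍-sym : ∀ {a b} → a ≍ b → b ≍ a
  ≍-sym {tag _}   {tag _}   p       = sym p
  ≍-sym {tag _}   {inc _ _} p       = sym p
  ≍-sym {inc _ _} {tag _}   p       = sym p
  ≍-sym {inc _ _} {inc _ _} (p , q) = sym p , ≍-sym q
  ≍-sym {prj _ _} {prj _ _} p       = λ e → ≍-sym (p (sym e))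
  ≍-sym {fun _ _} {fun _ _} p       = λ e → ≍-sym (p (cross⇒ew (transpose (ew⇒cross e))))
  ≍-sym {tag _}   {prj _ _} ()
  ≍-sym {tag _}   {fun _ _} ()
  ≍-sym {inc _ _} {prj _ _} ()
  ≍-sym {inc _ _} {fun _ _} ()
  ≍-sym {prj _ _} {tag _}   ()
  ≍-sym {prj _ _} {inc _ _} ()
  ≍-sym {prj _ _} {fun _ _} ()
  ≍-sym {fun _ _} {tag _}   ()
  ≍-sym {fun _ _} {inc _ _} ()
  ≍-sym {fun _ _} {prj _ _} ()

  transpose : ∀ {X Y} → Cross X Y → Cross Y X
  transpose {Y = []}    _ = []
  transpose {Y = _ ∷ _} c = column c ∷ transpose (All.map All.tail c)

  column : ∀ {X y Y} → Cross X (y ∷ Y) → All (y ≍_) X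
  column []             = []
  column ((p ∷ _) ∷ ps) = ≍-sym p ∷ column ps

mutual
  ≍-down : ∀ {a b c} → a ≍ b → c ≤P b → a ≍ c
  ≍-down             p       tag≤tag        = p
  ≍-down {tag _}     p       tag≤inc        = p
  ≍-down {inc _ _}   (e , _) tag≤inc        = e
  ≍-down {tag _}     p       (inc≤inc _)    = p
  ≍-down {inc _ _}   (e , p) (inc≤inc q)    = e , ≍-down p q
  ≍-down {prj _ _}   p       (prj≤prj q)    = λ e → ≍-down (p e) q
  ≍-down {fun _ _}   p       (fun≤fun c q)  = λ e → ≍-down (p (cross⇒ew (Cross-⊑ (ew⇒cross e) c))) q
  ≍-down {prj _ _}   ()      tag≤inc
  ≍-down {fun _ _}   ()      tag≤inc
  ≍-down {prj _ _}   ()      (inc≤inc _)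
  ≍-down {fun _ _}   ()      (inc≤inc _)
  ≍-down {tag _}     ()      (prj≤prj _)
  ≍-down {inc _ _}   ()      (prj≤prj _)
  ≍-down {fun _ _}   ()      (prj≤prj _)
  ≍-down {tag _}     ()      (fun≤fun _ _)
  ≍-down {inc _ _}   ()      (fun≤fun _ _)
  ≍-down {prj _ _}   ()      (fun≤fun _ _)

  Cross-⊑ : ∀ {A X Y} → Cross A X → Y ⊑ X → Cross A Y
  Cross-⊑ []       _ = []
  Cross-⊑ (h ∷ hs) c = All-⊑ h c ∷ Cross-⊑ hs c

  All-⊑ : ∀ {a X Y} → All (a ≍_) X → Y ⊑ X → All (a ≍_) Y
  All-⊑ h []       = []
  All-⊑ h (p ∷ ps) = Below-≍ h p ∷ All-⊑ h ps

  Below-≍ : ∀ {a X c} → All (a ≍_) X → Below X c → a ≍ c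
  Below-≍ (h ∷ _)  (here q)  = ≍-down h q
  Below-≍ (_ ∷ hs) (there p) = Below-≍ hs p

≍-downˡ : ∀ {a b c} → c ≤P a → a ≍ b → c ≍ b
≍-downˡ q p = ≍-sym (≍-down (≍-sym p) q)

Below-consistent : ∀ {X a b} → AllPairs _≍_ X → Below X a → Below X b → a ≍ b
Below-consistent (_ ∷ _)  (here p)  (here q)  = ≍-downˡ p (≍-down ≍-refl q)
Below-consistent (h ∷ _)  (here p)  (there q) = ≍-downˡ p (Below-≍ h q)
Below-consistent (h ∷ _)  (there p) (here q)  = ≍-sym (≍-downˡ q (Below-≍ h p))
Below-consistent (_ ∷ hs) (there p) (there q) = Below-consistent hs p q

AllPairs-from : ∀ {P : Prime → Set} → (∀ {a b} → P a → P b → a ≍ b) →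
                ∀ {X} → All P X → AllPairs _≍_ X
AllPairs-from c []       = []
AllPairs-from c (p ∷ ps) = All.map (c p) ps ∷ AllPairs-from c ps

Cross-from : ∀ {P Q : Prime → Set} → (∀ {a b} → P a → Q b → a ≍ b) →
             ∀ {X Y} → All P X → All Q Y → Cross X Y
Cross-from c ps qs = All.map (λ p → All.map (c p) qs) ps

-- Antichains.  antichainOf L has the same downward closure as L but is pairwise
-- incomparable, as the argument X of a function prime (X, b) must be.
Antichain : List Prime → Set
Antichain = AllPairs Incomparable

dropBelow : Prime → List Prime → List Prime
dropBelow x = filter (λ a → ¬? (a ≤? x))

insert : Prime → List Prime → List Prime
insert x A with Below? A x
... | yes _ = A
... | no  _ = x ∷ dropBelow x A

insert-All : ∀ {Q : Prime → Set} {x A} → Q x → All Q A → All Q (insert x A)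
insert-All {x = x} {A} qx qA with Below? A x
... | yes _ = qA
... | no  _ = qx ∷ AllP.filter⁺ (λ a → ¬? (a ≤? x)) qA

insert-antichain : ∀ {x A} → Antichain A → Antichain (insert x A)
insert-antichain {x} {A} ac with Below? A x
... | yes _   = ac
... | no  x∉A = All.zip (AllP.filter⁺ (λ a → ¬? (a ≤? x)) (AllP.¬Any⇒All¬ A x∉A) ,
                          AllP.all-filter (λ a → ¬? (a ≤? x)) A)
                ∷ AllPairsP.filter⁺ (λ a → ¬? (a ≤? x)) ac

Below-dropBelow : ∀ {x A b} → Below A b → Below (x ∷ dropBelow x A) b
Below-dropBelow {x} b∈A with AnyP.filter⁺ (λ a → ¬? (a ≤? x)) b∈A
... | inj₁ p    = there p
... | inj₂ ¬¬≤x = here (≤P-trans (AnyP.lookup-result b∈A)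
                                 (decidable-stable (Any.lookup b∈A ≤? x) ¬¬≤x))

insert-covers : ∀ {x A} → (x ∷ A) ⊑ insert x A
insert-covers {x} {A} with Below? A x
... | yes x∈A = x∈A ∷ ⊑-refl
... | no  _   = here ≤P-refl ∷ All.map Below-dropBelow ⊑-refl

antichainOf : List Prime → List Prime
antichainOf = foldr insert []

antichainOf-All : ∀ {Q : Prime → Set} {L} → All Q L → All Q (antichainOf L)
antichainOf-All []       = []
antichainOf-All (q ∷ qs) = insert-All q (antichainOf-All qs)

antichainOf-antichain : ∀ L → Antichain (antichainOf L)
antichainOf-antichain []      = []
antichainOf-antichain (_ ∷ L) = insert-antichain (antichainOf-antichain L)

antichainOf-covers : ∀ L → L ⊑ antichainOf L
antichainOf-covers []      = []
antichainOf-covers (_ ∷ L) = ⊑-trans (here ≤P-refl ∷ All.map there (antichainOf-covers L))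
                                     insert-covers

codomain : ∀ {X b ρ τ} → HasTy (fun X b) (ρ ⇒ τ) → HasTy b τ
codomain (funT _ _ _ hb) = hb

domain : ∀ {X b ρ τ} → HasTy (fun X b) (ρ ⇒ τ) → ValidArg ρ X
domain (funT hX cX aX _) = hX , cX , aX

funTy : ∀ {X b ρ τ} → ValidArg ρ X → HasTy b τ → HasTy (fun X b) (ρ ⇒ τ)
funTy (hX , cX , aX) hb = funT hX cX aX hb

∈D-retype : ∀ {ρ τ e} → (∀ {a} → HasTy a ρ ⇔ HasTy a τ) → e ∈D ρ → e ∈D τ
∈D-retype ρ⇔τ (ty , down , cons) = (λ p → to ρ⇔τ (ty p)) , (λ h → down (from ρ⇔τ h)) , cons

μ-unfold : ∀ {a τ} → HasTy a (μ τ) ⇔ HasTy a (unfold τ)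
μ-unfold = mk⇔ (λ { (fold h) → h }) fold

sub-ren : ∀ {n m} (r : Fin n → Fin m) (s : Fin m → Ty n) → (∀ i → s (r i) ≡ tvar i) →
          ∀ σ → sub s (ren r σ) ≡ σ
sub-ren r s inv (tvar i) = inv i
sub-ren r s inv void     = refl
sub-ren r s inv (σ ⊕ τ)  = cong₂ _⊕_ (sub-ren r s inv σ) (sub-ren r s inv τ)
sub-ren r s inv (σ ⊗ τ)  = cong₂ _⊗_ (sub-ren r s inv σ) (sub-ren r s inv τ)
sub-ren r s inv (σ ⇒ τ)  = cong₂ _⇒_ (sub-ren r s inv σ) (sub-ren r s inv τ)
sub-ren r s inv (μ σ)    = cong μ (sub-ren (ext r) (exts s) inv′ σ)
  where
  inv′ : ∀ i → exts s (ext r i) ≡ tvar i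
  inv′ zero    = refl
  inv′ (suc i) = cong (ren suc) (inv i)

Tself-unfold : ∀ σ → unfold (tvar zero ⇒ ren suc σ) ≡ (Tself σ ⇒ σ)
Tself-unfold σ = cong (Tself σ ⇒_) (sub-ren suc (λ _ → Tself σ) (λ ()) σ)

Tself-ty : ∀ {σ a} → HasTy a (Tself σ) ⇔ HasTy a (Tself σ ⇒ σ)
Tself-ty {σ} {a} = ⇔.trans μ-unfold
  (subst (λ υ → HasTy a (unfold (tvar zero ⇒ ren suc σ)) ⇔ HasTy a υ) (Tself-unfold σ) ⇔.refl)

≐-refl : ∀ {d} → d ≐ d
≐-refl _ = ⇔.refl

≐-sym : ∀ {d e} → d ≐ e → e ≐ d
≐-sym p a = ⇔.sym (p a)

≐-trans : ∀ {d e g} → d ≐ e → e ≐ g → d ≐ g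
≐-trans p q a = ⇔.trans (p a) (q a)

≐⇒⊆ : ∀ {d e} → d ≐ e → d ⊆E e
≐⇒⊆ p a = to (p a)

∈D-≐ : ∀ {ρ d e} → d ≐ e → d ∈D ρ → e ∈D ρ
∈D-≐ d≐e (ty , down , cons) =
  (λ p → ty (from (d≐e _) p)) ,
  (λ h q p → to (d≐e _) (down h q (from (d≐e _) p))) ,
  (λ p q → cons (from (d≐e _) p) (from (d≐e _) q))

select : ∀ {P Q : Prime → Set} {Z} → Any P Z → All Q Z → ∃ λ z → P z × Q z
select p qs = -, swap (All.lookupAny qs p)

↓∈D : ∀ {ρ X} → AllPairs _≍_ X → ↓ ρ X ∈D ρ
↓∈D cX = proj₁ , (λ h q (_ , p) → h , ≤-Below q p) ,
         (λ (_ , p) (_ , q) → Below-consistent cX p q)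

↓-least : ∀ {ρ e X} → e ∈D ρ → All e X → ↓ ρ X ⊆E e
↓-least (_ , down , _) eX _ (h , p) with select p eX
... | _ , a≤x , ex = down h a≤x ex

↓-mono : ∀ {ρ X Y} → Y ⊑ X → ↓ ρ Y ⊆E ↓ ρ X
↓-mono c _ (h , p) = h , Below-trans p c

↓-++ˡ : ∀ {ρ} X {Y} → ↓ ρ X ⊆E ↓ ρ (X ++ Y)
↓-++ˡ _ _ (h , p) = h , AnyP.++⁺ˡ p

↓-++ʳ : ∀ {ρ} X {Y} → ↓ ρ Y ⊆E ↓ ρ (X ++ Y)
↓-++ʳ X _ (h , p) = h , AnyP.++⁺ʳ X p

appE-mono : ∀ {r r′ d d′} → r ⊆E r′ → d ⊆E d′ → appE r d ⊆E appE r′ d′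
appE-mono p q _ (X , dX , rX) = X , All.map (q _) dX , p _ rX

appE-cong : ∀ {r r′ d d′} → r ≐ r′ → d ≐ d′ → appE r d ≐ appE r′ d′
appE-cong p q a = mk⇔ (appE-mono (≐⇒⊆ p) (≐⇒⊆ q) a)
                      (appE-mono (≐⇒⊆ (≐-sym p)) (≐⇒⊆ (≐-sym q)) a)

appE∈D : ∀ {ρ τ r e} → r ∈D (ρ ⇒ τ) → e ∈D ρ → appE r e ∈D τ
appE∈D (rTy , rDown , rCons) (_ , _ , eCons) =
  (λ (_ , _ , rX) → codomain (rTy rX)) ,
  (λ h q (X , eX , rX) → X , eX , rDown (funTy (domain (rTy rX)) h) (fun≤fun ⊑-refl q) rX) ,
  (λ (_ , eX , rX) (_ , eY , rY) → rCons rX rY (cross⇒ew (Cross-from eCons eX eY)))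

PrE-ind : ∀ {ρ F} (P : Prime → Set) → (∀ {X b} → ValidArg ρ X → F (↓ ρ X) b → P (fun X b)) →
          ∀ {a} → PrE ρ F a → P a
PrE-ind _ h {fun _ _} (vX , Fb) = h vX Fb
PrE-ind _ h {tag _}   ()
PrE-ind _ h {inc _ _} ()
PrE-ind _ h {prj _ _} ()

PrE-cong : ∀ {ρ F G} → (∀ {X} → ValidArg ρ X → F (↓ ρ X) ≐ G (↓ ρ X)) → PrE ρ F ≐ PrE ρ G
PrE-cong {ρ} {F} {G} F≐G _ = mk⇔ (PrE-ind (PrE ρ G) λ vX Fb → vX , to (F≐G vX _) Fb)
                                 (PrE-ind (PrE ρ F) λ vX Gb → vX , from (F≐G vX _) Gb)

Monotone : (Elem → Elem) → Set₁
Monotone F = ∀ {d e} → d ⊆E e → F d ⊆E F e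

PrE∈D : ∀ {ρ τ F} → Monotone F → (∀ {e} → e ∈D ρ → F e ∈D τ) → PrE ρ F ∈D (ρ ⇒ τ)
PrE∈D {ρ} {τ} {F} mono F∈D =
  PrE-ind (λ a → HasTy a (ρ ⇒ τ)) (λ vX Fb → funTy vX (proj₁ (F↓∈D vX) Fb)) ,
  (λ {a} h q p → PrE-ind (λ b → a ≤P b → PrE ρ F a) (λ _ Fb q → down h q Fb) p q) ,
  (λ p₁ p₂ → PrE-ind (λ a → ∀ {b} → PrE ρ F b → a ≍ b)
               (λ v₁ F₁ → PrE-ind (λ b → fun _ _ ≍ b) (λ v₂ F₂ ew → consistent v₁ v₂ ew F₁ F₂))
               p₁ p₂)
  where
  F↓∈D : ∀ {X} → ValidArg ρ X → F (↓ ρ X) ∈D τ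
  F↓∈D (_ , cX , _) = F∈D (↓∈D cX)

  down : ∀ {a X b} → HasTy a (ρ ⇒ τ) → a ≤P fun X b → F (↓ ρ X) b → PrE ρ F a
  down h (fun≤fun c q) Fb =
    domain h , proj₁ (proj₂ (F↓∈D (domain h))) (codomain h) q (mono (↓-mono c) _ Fb)

  -- F(↓X₁) and F(↓X₂) both lie in the element F(↓(X₁ ++ X₂))
  consistent : ∀ {X₁ X₂ b₁ b₂} → ValidArg ρ X₁ → ValidArg ρ X₂ → Elementwise≍ X₁ X₂ →
               F (↓ ρ X₁) b₁ → F (↓ ρ X₂) b₂ → b₁ ≍ b₂
  consistent {X₁} (_ , c₁ , _) (_ , c₂ , _) ew F₁ F₂ =
    proj₂ (proj₂ (F∈D (↓∈D (AllPairsP.++⁺ c₁ c₂ (ew⇒cross ew)))))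
      (mono (↓-++ˡ X₁) _ F₁) (mono (↓-++ʳ X₁) _ F₂)

Continuous : Ty 0 → (Elem → Elem) → Set₁
Continuous ρ F = ∀ {e} → e ∈D ρ → ∀ {b} → F e b → Σ (List Prime) λ L → All e L × F (↓ ρ L) b

gather : ∀ {ρ K e} → Monotone K → Continuous ρ K → e ∈D ρ →
         ∀ {X} → All (K e) X → Σ (List Prime) λ L → All e L × All (K (↓ ρ L)) X
gather mono cont eD []       = [] , [] , []
gather mono cont eD (k ∷ ks) with cont eD k | gather mono cont eD ks
... | L₀ , eL₀ , k₀ | L₁ , eL₁ , ks₁ =
  L₀ ++ L₁ , AllP.++⁺ eL₀ eL₁ , mono (↓-++ˡ L₀) _ k₀ ∷ All.map (mono (↓-++ʳ L₀) _) ks₁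

id-continuous : ∀ {ρ} → Continuous ρ id
id-continuous (ty , _ , _) {b} eb = b ∷ [] , eb ∷ [] , ty eb , here ≤P-refl

const-continuous : ∀ {ρ d} → Continuous ρ (λ _ → d)
const-continuous _ db = [] , [] , db

app-monotone : ∀ {G K} → Monotone G → Monotone K → Monotone (λ e → appE (G e) (K e))
app-monotone mG mK p = appE-mono (mG p) (mK p)

app-continuous : ∀ {ρ G K} → Monotone G → Continuous ρ G → Monotone K → Continuous ρ K →
                 Continuous ρ (λ e → appE (G e) (K e))
app-continuous mG cG mK cK eD (X , kX , gX) with cG eD gX | gather mK cK eD kX
... | L₀ , eL₀ , g₀ | L₁ , eL₁ , kX₁ =
  L₀ ++ L₁ , AllP.++⁺ eL₀ eL₁ , X , All.map (mK (↓-++ʳ L₀) _) kX₁ , mG (↓-++ˡ L₀) _ g₀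

antichain-valid : ∀ {ρ e L} → e ∈D ρ → All e L → ValidArg ρ (antichainOf L)
antichain-valid {L = L} (ty , _ , cons) eL =
  antichainOf-All (All.map ty eL) , AllPairs-from cons (antichainOf-All eL) , antichainOf-antichain L

β-law : ∀ {ρ F e} → Monotone F → Continuous ρ F → e ∈D ρ → appE (PrE ρ F) e ≐ F e
β-law {ρ} {F} {e} mono cont eD b = mk⇔ sound complete
  where
  sound : appE (PrE ρ F) e b → F e b
  sound (X , eX , _ , Fb) = mono (↓-least eD eX) b Fb

  complete : F e b → appE (PrE ρ F) e b
  complete Fb with cont eD Fb
  ... | L , eL , FLb = antichainOf L , antichainOf-All eL , antichain-valid eD eL ,
                       mono (↓-mono (antichainOf-covers L)) b FLb

iter-mono : ∀ n → Monotone (λ f → iter f n)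
iter-mono zero    _ _ ()
iter-mono (suc n) p = appE-mono p (iter-mono n p)

iter-≤ : ∀ {f n m} → n ≤ m → iter f n ⊆E iter f m
iter-≤ z≤n       _ ()
iter-≤ {f} (s≤s n≤m) = appE-mono {f} (λ _ fa → fa) (iter-≤ n≤m)

iter∈D : ∀ {σ f} → f ∈D (σ ⇒ σ) → ∀ n → iter f n ∈D σ
iter∈D fD zero    = (λ ()) , (λ _ _ ()) , (λ ())
iter∈D fD (suc n) = appE∈D fD (iter∈D fD n)

iter-continuous : ∀ {ρ} n → Continuous ρ (λ f → iter f n)
iter-continuous zero    _ ()
iter-continuous (suc n) = app-continuous id id-continuous (iter-mono n) (iter-continuous n)

⋃-bound : ∀ {f Y} → All (⋃iter f) Y → Σ ℕ λ N → All (iter f N) Y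
⋃-bound []             = 0 , []
⋃-bound ((n , p) ∷ ps) with ⋃-bound ps
... | N , qs = n ⊔ N , iter-≤ (m≤m⊔n n N) _ p ∷ All.map (iter-≤ (m≤n⊔m n N) _) qs

⋃iter∈D : ∀ {σ f} → f ∈D (σ ⇒ σ) → ⋃iter f ∈D σ
⋃iter∈D fD =
  (λ (n , p) → proj₁ (iter∈D fD n) p) ,
  (λ h q (n , p) → n , proj₁ (proj₂ (iter∈D fD n)) h q p) ,
  (λ (n , p) (m , q) → proj₂ (proj₂ (iter∈D fD (n ⊔ m)))
                         (iter-≤ (m≤m⊔n n m) _ p) (iter-≤ (m≤n⊔m n m) _ q))

⋃iter-fix : ∀ {f} → appE f (⋃iter f) ≐ ⋃iter f
⋃iter-fix {f} a = mk⇔ unroll roll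
  where
  unroll : appE f (⋃iter f) a → ⋃iter f a
  unroll (Y , Y⊆⋃ , fY) with ⋃-bound Y⊆⋃
  ... | N , Y⊆fᴺ = suc N , Y , Y⊆fᴺ , fY

  roll : ⋃iter f a → appE f (⋃iter f) a
  roll (zero  , ())
  roll (suc n , Y , Y⊆fⁿ , fY) = Y , All.map (n ,_) Y⊆fⁿ , fY

⋃iter-least : ∀ {f e} → appE f e ⊆E e → ⋃iter f ⊆E e
⋃iter-least {f} {e} pre a (n , p) = iter⊆ n a p
  where
  iter⊆ : ∀ n → iter f n ⊆E e
  iter⊆ zero    _ ()
  iter⊆ (suc n) a p = pre a (appE-mono {f} (λ _ fa → fa) (iter⊆ n) a p)

⋃iter-lfp : ∀ {σ f} → f ∈D (σ ⇒ σ) → IsLeastFixedPoint σ (appE f) (⋃iter f)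
⋃iter-lfp fD = ⋃iter∈D fD , ⋃iter-fix , λ _ _ fix → ⋃iter-least (≐⇒⊆ fix)

⋃iter-monotone : Monotone ⋃iter
⋃iter-monotone p a (n , q) = n , iter-mono n p a q

⋃iter-continuous : ∀ {ρ} → Continuous ρ ⋃iter
⋃iter-continuous fD (n , p) with iter-continuous n fD p
... | L , fL , q = L , fL , n , q

lfp-≐ : ∀ {σ f d d′} → d ≐ d′ →
        IsLeastFixedPoint σ (appE f) d → IsLeastFixedPoint σ (appE f) d′
lfp-≐ {f = f} d≐d′ (dD , fix , least) =
  ∈D-≐ d≐d′ dD ,
  ≐-trans (appE-cong (≐-refl {f}) (≐-sym d≐d′)) (≐-trans fix d≐d′) ,
  λ e eD fix′ a p → least e eD fix′ a (from (d≐d′ a) p)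

selfBody : Elem → Elem → Elem
selfBody d e = appE d (appE e e)

Half : Ty 0 → Elem → Elem
Half σ d = PrE (Tself σ) (selfBody d)

module SelfApplication {σ : Ty 0} {d : Elem} (dD : d ∈D (σ ⇒ σ)) where

  T : Ty 0
  T = Tself σ

  H : Elem
  H = Half σ d

  selfApp-monotone : Monotone (λ e → appE e e)
  selfApp-monotone = app-monotone id id

  body-monotone : Monotone (selfBody d)
  body-monotone = app-monotone {G = λ _ → d} (λ _ _ da → da) selfApp-monotone

  body-continuous : Continuous T (selfBody d)
  body-continuous =
    app-continuous {G = λ _ → d} (λ _ _ da → da) const-continuous
                   selfApp-monotone (app-continuous id id-continuous id id-continuous)

  body∈D : ∀ {e} → e ∈D T → selfBody d e ∈D σ
  body∈D eD = appE∈D dD (appE∈D (∈D-retype Tself-ty eD) eD)   -- e ∈ D_T acts as a D_T → D_σ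

  H∈D : H ∈D T
  H∈D = ∈D-retype (⇔.sym Tself-ty) (PrE∈D body-monotone body∈D)

  -- by the β-law H H = d(H H), so H H contains the least fixed point of d
  HH-unroll : appE H H ≐ appE d (appE H H)
  HH-unroll = β-law body-monotone body-continuous H∈D

  HH-complete : ⋃iter d ⊆E appE H H
  HH-complete = ⋃iter-least (≐⇒⊆ (≐-sym HH-unroll))

  -- Conversely, by induction on the primes (W, y) of H: if W ⊆ H then y ∈ ⋃ d^n(⊥)
  Sound : Prime → Set
  Sound (fun W y) = All H W → H (fun W y) → ⋃iter d y
  Sound _         = ⊤

  -- a prime y of (↓Z)(↓Z) comes from some (W′, y′) ∈ Z with y ≤ y′ and W′ ⊆ ↓Z ⊆ H
  ↓self-sound : ∀ {Z} → All H Z → All Sound Z → appE (↓ T Z) (↓ T Z) ⊆E ⋃iter d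
  ↓self-sound hZ sZ y (W , W⊆↓Z , Wy-ty , Wy∈↓Z) with select Wy∈↓Z (All.zip (hZ , sZ))
  ... | fun W′ y′ , fun≤fun W′⊑W y≤y′ , Hz , Sz =
    proj₁ (proj₂ (⋃iter∈D dD)) (codomain (to Tself-ty Wy-ty)) y≤y′ (Sz W′⊆H Hz)
    where
    W′⊆H : All H W′
    W′⊆H = All.map (↓-least H∈D hZ _)
                   (All.zip (proj₁ (proj₁ Hz) , ⊑-trans W′⊑W (All.map proj₂ W⊆↓Z)))

  mutual
    sound-fun : ∀ Z b → All H Z → H (fun Z b) → ⋃iter d b
    sound-fun Z b hZ (_ , Y , Y⊆ZZ , dY) =
      to (⋃iter-fix b) (Y , All.map (↓self-sound hZ (sound-all Z) _) Y⊆ZZ , dY)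

    sound-all : ∀ Z → All Sound Z
    sound-all []      = []
    sound-all (z ∷ Z) = sound-prime z ∷ sound-all Z

    sound-prime : ∀ z → Sound z
    sound-prime (fun W y) = sound-fun W y
    sound-prime (tag _)   = tt
    sound-prime (inc _ _) = tt
    sound-prime (prj _ _) = tt

  HH-sound : appE H H ⊆E ⋃iter d
  HH-sound b (Z , hZ , Hb) = sound-fun Z b hZ Hb

  self-application : appE H H ≐ ⋃iter d
  self-application b = mk⇔ (HH-sound b) (HH-complete b)

update-hit : ∀ {ε x τ d} → (ε [ x , τ ↦ d ]) x τ ≐ d
update-hit _ = mk⇔ [ proj₂ , (λ (x≢x , _) → ⊥-elim (x≢x (refl , refl))) ]′
                   (λ da → inj₁ ((refl , refl) , da))

update-miss : ∀ {ε x τ d y υ} → ¬ (x ≡ y × τ ≡ υ) → (ε [ x , τ ↦ d ]) y υ ≐ ε y υ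
update-miss x≢y _ = mk⇔ [ (λ (x≡y , _) → ⊥-elim (x≢y x≡y)) , proj₂ ]′ (λ p → inj₂ (x≢y , p))

Yhalf-≐ : ∀ {σ ε d} → ⟦ Yhalf σ ⟧ (ε [ 0 , σ ⇒ σ ↦ d ]) ≐ Half σ d
Yhalf-≐ {σ} {ε} {d} = PrE-cong λ {X} _ →
  appE-cong (y↦d (↓ (Tself σ) X)) (appE-cong (x↦e (↓ (Tself σ) X)) (x↦e (↓ (Tself σ) X)))
  where
  ε₁ : Env
  ε₁ = ε [ 0 , σ ⇒ σ ↦ d ]

  y↦d : ∀ e → (ε₁ [ 1 , Tself σ ↦ e ]) 0 (σ ⇒ σ) ≐ d
  y↦d e = ≐-trans (update-miss {ε₁} λ { (() , _) }) (update-hit {ε})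

  x↦e : ∀ e → (ε₁ [ 1 , Tself σ ↦ e ]) 1 (Tself σ) ≐ e
  x↦e e = update-hit {ε₁}

-- first claim: [[Y_σ]]ε = Pr(f ↦ ⋃ f^n(⊥)), by self-application at d = ↓X
Ycomb-≐ : ∀ σ ε → ⟦ Ycomb σ ⟧ ε ≐ PrE (σ ⇒ σ) ⋃iter
Ycomb-≐ σ ε = PrE-cong λ (_ , cX , _) →
  ≐-trans (appE-cong (Yhalf-≐ {ε = ε}) (Yhalf-≐ {ε = ε}))
          (SelfApplication.self-application (↓∈D cX))

mainTheorem11 : (σ : Ty 0) (ε : Env) → WellTypedEnv ε →
    (∀ a → ⟦ Ycomb σ ⟧ ε a ⇔ PrE (σ ⇒ σ) ⋃iter a)
    × (∀ f → f ∈D (σ ⇒ σ) →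
       IsLeastFixedPoint σ (appE f) (appE (⟦ Ycomb σ ⟧ ε) f))
-- Y_σ is closed
mainTheorem11 σ ε _ = Ycomb-≐ σ ε , λ f fD → lfp-≐ {f = f} (≐-sym (Y-applied fD)) (⋃iter-lfp fD)
  where
  Y-applied : ∀ {f} → f ∈D (σ ⇒ σ) → appE (⟦ Ycomb σ ⟧ ε) f ≐ ⋃iter f
  Y-applied {f} fD = ≐-trans (appE-cong (Ycomb-≐ σ ε) (≐-refl {f}))
                             (β-law ⋃iter-monotone ⋃iter-continuous fD)
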